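{- For every $n\ge1$, the map $$b_n:B_n\to\Big\{\sum_{i=0}^{n-1}a_i\,2^i i!\ :\ a_i\in\mathbb Z,\ 0\le a_i\le 2i+1\Big\},\qquad b_n(\pi)=\sum_{i=1}^{n}\mathrm{inv}_{n-i+1}(\pi)\,2^{i-1}(i-1)!,$$ is well defined and is a bijection.
   Context: $B_n$ is the hyperoctahedral group of signed permutations: bijections $\pi$ of $\{\pm1,\dots,\pm n\}$ with $\pi(-x)=-\pi(x)$; equivalently $\pi$ is determined by $(\pi(1),\dots,\pi(n))$ with $\pi(i)\in\{\pm1,\dots,\pm n\}$ and $(|\pi(1)|,\dots,|\pi(n)|)$ a permutation of $\{1,\dots,n\}$. For $i\in\{1,\dots,n\}$ the number of $i$-inversions of $\pi$ is: if $\pi(i)=j>0$, $\mathrm{inv}_i(\pi)=\#\{k\in\{i+1,\dots,n\}: |\pi(k)|<j\}$; if $\pi(i)=-j<0$, $\mathrm{inv}_i(\pi)=1+\#\{k\in\{i+1,\dots,n\}: |\pi(k)|<j\}+2\,\#\{k\in\{i+1,\dots,n\}: |\pi(k)|>j\}$. -}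

module Defs where

open import Data.Nat using (ℕ; zero; suc; _+_; _*_; _∸_; _^_; _≤_; _<ᵇ_; _!)
open import Data.Bool using (Bool; true; false; _∧_; if_then_else_)
open import Data.Integer using (ℤ; +_; -[1+_]; ∣_∣)
open import Data.Fin using (Fin; toℕ; opposite)
open import Data.Vec using (Vec; lookup; toList)
open import Data.List using (List; map; allFin; upTo)
open import Data.Nat.ListAction using (sum)
open import Data.List.Relation.Binary.Permutation.Propositional using (_↭_)
open import Data.Product using (Σ; ∃; _×_)
open import Relation.Binary.PropositionalEquality using (_≡_)

-- A signed permutation π ∈ B_n, given by its window (π(1),…,π(n)) ∈ ℤ^n
-- (0-based: position i : Fin n stands for i+1), such that
-- (|π(1)|,…,|π(n)|) is a permutation of (1,…,n).
IsSignedPerm : (n : ℕ) → Vec ℤ n → Set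
IsSignedPerm n v = map ∣_∣ (toList v) ↭ map suc (upTo n)

SignedPerm : ℕ → Set
SignedPerm n = Σ (Vec ℤ n) (IsSignedPerm n)

count : (n : ℕ) → (Fin n → Bool) → ℕ
count n p = sum (map (λ k → if p k then 1 else 0) (allFin n))

-- inv_{i+1}(π) for position i : Fin n (the paper's 1-based index is i+1).
-- k ranges over positions strictly after i.
inv : (n : ℕ) → Vec ℤ n → Fin n → ℕ
inv n v i with lookup v i
... | + j     = count n (λ k → (toℕ i <ᵇ toℕ k) ∧ (∣ lookup v k ∣ <ᵇ j))
... | -[1+ m ] =
  1 + count n (λ k → (toℕ i <ᵇ toℕ k) ∧ (∣ lookup v k ∣ <ᵇ suc m))
    + 2 * count n (λ k → (toℕ i <ᵇ toℕ k) ∧ (suc m <ᵇ ∣ lookup v k ∣))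

-- b_n(π) = Σ_{i=1}^n inv_{n-i+1}(π) 2^{i-1} (i-1)!.
-- Writing i' = i-1 ∈ {0,…,n-1} (i' : Fin n), position n-i+1 (1-based) is the
-- 0-based position n-1-i' = opposite i'.
b : (n : ℕ) → Vec ℤ n → ℕ
b n v = sum (map (λ i → inv n v (opposite i) * (2 ^ toℕ i) * (toℕ i) !) (allFin n))

-- The target set { Σ_{i=0}^{n-1} a_i 2^i i! : a_i ∈ ℤ, 0 ≤ a_i ≤ 2i+1 }
-- (a_i ≥ 0, so a_i is taken in ℕ).
InTarget : (n : ℕ) → ℕ → Set
InTarget n m = ∃ λ (a : Vec ℕ n) →
  ((i : Fin n) → lookup a i ≤ 2 * toℕ i + 1) ×
  m ≡ sum (map (λ i → lookup a i * (2 ^ toℕ i) * (toℕ i) !) (allFin n))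

-- b_n factors as π ↦ (inv_n(π), …, inv_1(π)) followed by reading that string in the mixed
-- radix with place values 2^i i! and digit i in 0, …, 2i+1.  Since
-- 2^i i! + (2i+1)·2^i i! = 2^(i+1) (i+1)!, the reading is a bijection from such digit
-- strings onto the target set.  The first map is a bijection onto them by peeling off the
-- first entry: inv_1(π) depends only on π(1) and the set S of the other absolute values.
-- If r elements of S are smaller than |π(1)|, then inv_1(π) = r when π(1) > 0 and
-- inv_1(π) = 1 + r + 2(n−1−r) ≥ n when π(1) < 0, so each value in 0, …, 2n−1 comes from
-- exactly one choice of π(1).
module Submission where

open import Defs
open import Data.Nat using (ℕ; _≤_)
open import Data.Product using (∃; _×_; proj₁)
open import Relation.Binary.PropositionalEquality using (_≡_)

open import Data.Bool using (Bool; true; false; _∧_; if_then_else_)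
open import Data.Bool.Properties using (T-≡)
open import Data.Fin using (Fin; zero; suc; toℕ; opposite; fromℕ<)
open import Data.Fin.Properties using (toℕ-fromℕ<; opposite-prop; opposite-involutive)
open import Data.Integer using (ℤ; +_; -[1+_]; -_; ∣_∣)
open import Data.Integer.Properties using (∣-i∣≡∣i∣)
open import Data.List using (List; []; _∷_; map; allFin; upTo; length; lookup; removeAt)
open import Data.List.Membership.Propositional using (_∈_; _∉_)
open import Data.List.Membership.Propositional.Properties using (∈-lookup)
open import Data.List.Properties using (map-tabulate; map-cong; length-map; length-upTo; length-removeAt′)
open import Data.List.Relation.Binary.Permutation.Propositional
  using (_↭_; ↭-refl; ↭-reflexive; ↭-sym; ↭-trans; ↭-prep; ↭-swap; ↭⇒↭ₛ)
open import Data.List.Relation.Binary.Permutation.Propositional.Properties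
  using (map⁺; ∈-resp-↭; drop-∷; ↭-length)
open import Data.List.Relation.Unary.All as All using (All; []; _∷_)
open import Data.List.Relation.Unary.AllPairs as AllPairs using (AllPairs; []; _∷_)
import Data.List.Relation.Unary.All.Properties as All
import Data.List.Relation.Unary.AllPairs.Properties as AllPairs
open import Data.List.Relation.Unary.Any using (here; there)
open import Data.List.Relation.Unary.Unique.Propositional using (Unique)
open import Data.List.Relation.Unary.Unique.Propositional.Properties using (Unique[x∷xs]⇒x∉xs)
open import Data.Nat
open import Data.Nat.DivMod using (_%_; [m+kn]%n≡m%n; m<n⇒m%n≡m)
open import Data.Nat.ListAction using (sum)
open import Data.Nat.ListAction.Properties using (sum-↭)
open import Data.Nat.Properties
open import Algebra.Properties.CommutativeSemigroup +-commutativeSemigroup using (interchange)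
open import Data.Nat.Tactic.RingSolver using (solve-∀)
open import Data.Product using (_,_; proj₂)
open import Data.Vec using (Vec; []; _∷_; toList; _∷ʳ_; initLast; tabulate)
  renaming (lookup to lookupᵛ)
open import Data.Vec.Properties using (lookup∘tabulate; tabulate∘lookup; tabulate-cong; length-toList)
open import Function using (_∘_; id; Equivalence)
open import Relation.Binary.PropositionalEquality
  using (refl; sym; trans; cong; cong₂; subst; subst₂; setoid; module ≡-Reasoning)
open import Relation.Binary.Definitions using (tri<; tri≈; tri>)
open import Relation.Nullary using (¬_; yes; no; contradiction)
open import Data.List.Relation.Binary.Permutation.Setoid.Properties (setoid ℕ) using (Unique-resp-↭)

private
  variable
    A : Set
    m n : ℕ

indicator : Bool → ℕ
indicator b = if b then 1 else 0

countᵇ : (A → Bool) → List A → ℕ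
countᵇ P xs = sum (map (indicator ∘ P) xs)

sum-map-allFin-suc : (f : Fin (suc n) → ℕ) →
  sum (map f (allFin (suc n))) ≡ f zero + sum (map (f ∘ suc) (allFin n))
sum-map-allFin-suc f =
  cong (λ xs → f zero + sum xs) (trans (map-tabulate suc f) (sym (map-tabulate id (f ∘ suc))))

count-suc : (p : Fin (suc n) → Bool) → count (suc n) p ≡ indicator (p zero) + count n (p ∘ suc)
count-suc p = sum-map-allFin-suc (indicator ∘ p)

countᵇ-↭ : (P : A → Bool) {xs ys : List A} → xs ↭ ys → countᵇ P xs ≡ countᵇ P ys
countᵇ-↭ P p = sum-↭ (map⁺ (indicator ∘ P) p)

countᵇ-≤-length : (P : A → Bool) (xs : List A) → countᵇ P xs ≤ length xs
countᵇ-≤-length P []       = z≤n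
countᵇ-≤-length P (x ∷ xs) with P x
... | true  = s≤s (countᵇ-≤-length P xs)
... | false = m≤n⇒m≤1+n (countᵇ-≤-length P xs)

countᵇ-none : {P : A → Bool} {xs : List A} → All (λ x → P x ≡ false) xs → countᵇ P xs ≡ 0
countᵇ-none []                   = refl
countᵇ-none (Px≡false ∷ Pxs≡false) rewrite Px≡false = countᵇ-none Pxs≡false

countᵇ-all : {P : A → Bool} {xs : List A} → All (λ x → P x ≡ true) xs → countᵇ P xs ≡ length xs
countᵇ-all []                 = refl
countᵇ-all (Px≡true ∷ Pxs≡true) rewrite Px≡true = cong suc (countᵇ-all Pxs≡true)

<ᵇ-true : m < n → (m <ᵇ n) ≡ true
<ᵇ-true m<n = Equivalence.to T-≡ (<⇒<ᵇ m<n)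

<ᵇ-false : ¬ m < n → (m <ᵇ n) ≡ false
<ᵇ-false {m} {n} m≮n with m <ᵇ n in eq
... | false = refl
... | true  = contradiction (<ᵇ⇒< m n (Equivalence.from T-≡ eq)) m≮n

below above : ℕ → List ℕ → ℕ
below j = countᵇ (_<ᵇ j)
above j = countᵇ (j <ᵇ_)

below-∷-self : ∀ j xs → below j (j ∷ xs) ≡ below j xs
below-∷-self j xs = cong (λ b → indicator b + below j xs) (<ᵇ-false (n≮n j))

indicator-<ᵇ-mono : ∀ x {j j′} → j ≤ j′ → indicator (x <ᵇ j) ≤ indicator (x <ᵇ j′)
indicator-<ᵇ-mono x {j} j≤j′ with x <? j
... | yes x<j rewrite <ᵇ-true x<j | <ᵇ-true (<-≤-trans x<j j≤j′) = ≤-refl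
... | no  x≮j rewrite <ᵇ-false x≮j = z≤n

below-mono : ∀ {j j′} xs → j ≤ j′ → below j xs ≤ below j′ xs
below-mono []       _    = z≤n
below-mono (x ∷ xs) j≤j′ = +-mono-≤ (indicator-<ᵇ-mono x j≤j′) (below-mono xs j≤j′)

below-< : ∀ {j j′ xs} → j < j′ → j ∈ xs → below j xs < below j′ xs
below-< {j} {j′} {_ ∷ xs} j<j′ (here refl)
  rewrite <ᵇ-false (n≮n j) | <ᵇ-true j<j′ = s≤s (below-mono xs (<⇒≤ j<j′))
below-< {j} {j′} {x ∷ _} j<j′ (there j∈xs) =
  +-mono-≤-< (indicator-<ᵇ-mono x (<⇒≤ j<j′)) (below-< j<j′ j∈xs)

below-injective : ∀ {j j′ xs} → j ∈ xs → j′ ∈ xs → below j xs ≡ below j′ xs → j ≡ j′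
below-injective {j} {j′} j∈xs j′∈xs eq with <-cmp j j′
... | tri< j<j′ _ _ = contradiction eq (<⇒≢ (below-< j<j′ j∈xs))
... | tri≈ _ j≡j′ _ = j≡j′
... | tri> _ _ j>j′ = contradiction eq (>⇒≢ (below-< j>j′ j′∈xs))

below+above≤length : ∀ j xs → below j xs + above j xs ≤ length xs
below+above≤length j []       = z≤n
below+above≤length j (x ∷ xs) = begin
  (indicator (x <ᵇ j) + below j xs) + (indicator (j <ᵇ x) + above j xs)
    ≡⟨ interchange (indicator (x <ᵇ j)) _ _ _ ⟩
  (indicator (x <ᵇ j) + indicator (j <ᵇ x)) + (below j xs + above j xs)
    ≤⟨ +-mono-≤ head≤1 (below+above≤length j xs) ⟩
  suc (length xs) ∎
  where
  open ≤-Reasoning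
  head≤1 : indicator (x <ᵇ j) + indicator (j <ᵇ x) ≤ 1
  head≤1 with <-cmp x j
  ... | tri< x<j _ x≯j rewrite <ᵇ-true x<j | <ᵇ-false x≯j = ≤-refl
  ... | tri≈ _ refl _  rewrite <ᵇ-false (n≮n x) = z≤n
  ... | tri> x≮j _ x>j rewrite <ᵇ-false x≮j | <ᵇ-true x>j = ≤-refl

below+above≡length : ∀ j xs → j ∉ xs → below j xs + above j xs ≡ length xs
below+above≡length j []       _    = refl
below+above≡length j (x ∷ xs) j∉xs = begin
  (indicator (x <ᵇ j) + below j xs) + (indicator (j <ᵇ x) + above j xs)
    ≡⟨ interchange (indicator (x <ᵇ j)) _ _ _ ⟩
  (indicator (x <ᵇ j) + indicator (j <ᵇ x)) + (below j xs + above j xs)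
    ≡⟨ cong₂ _+_ head≡1 (below+above≡length j xs (j∉xs ∘ there)) ⟩
  suc (length xs) ∎
  where
  open ≡-Reasoning
  head≡1 : indicator (x <ᵇ j) + indicator (j <ᵇ x) ≡ 1
  head≡1 with <-cmp x j
  ... | tri< x<j _ x≯j rewrite <ᵇ-true x<j | <ᵇ-false x≯j = refl
  ... | tri≈ _ x≡j _   = contradiction (here (sym x≡j)) j∉xs
  ... | tri> x≮j _ x>j rewrite <ᵇ-false x≮j | <ᵇ-true x>j = refl

lookup∷removeAt↭ : (xs : List A) (i : Fin (length xs)) → lookup xs i ∷ removeAt xs i ↭ xs
lookup∷removeAt↭ (x ∷ xs) zero    = ↭-refl
lookup∷removeAt↭ (x ∷ xs) (suc i) = ↭-trans (↭-swap _ x ↭-refl) (↭-prep x (lookup∷removeAt↭ xs i))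

All-removeAt : {P : A → Set} {xs : List A} → All P xs → (i : Fin (length xs)) → All P (removeAt xs i)
All-removeAt (_  ∷ pxs) zero    = pxs
All-removeAt (px ∷ pxs) (suc i) = px ∷ All-removeAt pxs i

AllPairs-removeAt : {R : A → A → Set} {xs : List A} → AllPairs R xs →
  (i : Fin (length xs)) → AllPairs R (removeAt xs i)
AllPairs-removeAt (_  ∷ rxs) zero    = rxs
AllPairs-removeAt (rx ∷ rxs) (suc i) = All-removeAt rx i ∷ AllPairs-removeAt rxs i

below-lookup : ∀ {xs} → AllPairs _<_ xs → (i : Fin (length xs)) →
  below (lookup xs i) (removeAt xs i) ≡ toℕ i
below-lookup (x< ∷ _)      zero    = countᵇ-none (All.map (<ᵇ-false ∘ <⇒≯) x<)
below-lookup {x ∷ xs} (x< ∷ sorted) (suc i) =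
  cong₂ _+_ (cong indicator (<ᵇ-true (All.lookup x< (∈-lookup i)))) (below-lookup sorted i)

above-lookup : ∀ {xs} → AllPairs _<_ xs → (i : Fin (length xs)) →
  above (lookup xs i) (removeAt xs i) ≡ length xs ∸ suc (toℕ i)
above-lookup (x< ∷ _)      zero    = countᵇ-all (All.map <ᵇ-true x<)
above-lookup {x ∷ xs} (x< ∷ sorted) (suc i) =
  cong₂ _+_ (cong indicator (<ᵇ-false (<⇒≯ (All.lookup x< (∈-lookup i))))) (above-lookup sorted i)

-- The inversion number of a single entry

magnitudes : Vec ℤ n → List ℕ
magnitudes v = map ∣_∣ (toList v)

length-magnitudes : (v : Vec ℤ n) → length (magnitudes v) ≡ n
length-magnitudes v = trans (length-map ∣_∣ (toList v)) (length-toList v)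

invAgainst : ℤ → List ℕ → ℕ
invAgainst (+ j)    xs = below j xs
invAgainst -[1+ m ] xs = 1 + below (suc m) xs + 2 * above (suc m) xs

invAgainst-↭ : ∀ x {xs ys} → xs ↭ ys → invAgainst x xs ≡ invAgainst x ys
invAgainst-↭ (+ j)    p = countᵇ-↭ _ p
invAgainst-↭ -[1+ m ] p = cong₂ (λ a c → 1 + a + 2 * c) (countᵇ-↭ _ p) (countᵇ-↭ _ p)

m+2*n≡m+n+n : ∀ m n → m + 2 * n ≡ m + n + n
m+2*n≡m+n+n = solve-∀

invAgainst-≤ : ∀ x xs → invAgainst x xs ≤ 2 * length xs + 1
invAgainst-≤ (+ j) xs = ≤-trans (countᵇ-≤-length _ xs) (≤-trans (m≤m+n _ _) (m≤m+n _ 1))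
invAgainst-≤ -[1+ m ] xs = begin
  1 + a + 2 * c     ≡⟨ cong suc (m+2*n≡m+n+n a c) ⟩
  1 + (a + c + c)   ≤⟨ s≤s (+-mono-≤ a+c≤ (≤-trans (m≤n+m c a) a+c≤)) ⟩
  1 + (ℓ + ℓ)       ≡⟨ 1+[n+n]≡2*n+1 ℓ ⟩
  2 * ℓ + 1         ∎
  where
  open ≤-Reasoning
  a = below (suc m) xs
  c = above (suc m) xs
  ℓ = length xs
  a+c≤ = below+above≤length (suc m) xs
  1+[n+n]≡2*n+1 : ∀ n → 1 + (n + n) ≡ 2 * n + 1
  1+[n+n]≡2*n+1 = solve-∀

invAgainst-nonneg<neg : ∀ j m {xs ys} → length xs ≡ length ys → suc m ∉ ys →
  invAgainst (+ j) xs < invAgainst -[1+ m ] ys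
invAgainst-nonneg<neg j m {xs} {ys} len m∉ys = begin-strict
  below j xs                                          ≤⟨ countᵇ-≤-length _ xs ⟩
  length xs                                           ≡⟨ len ⟩
  length ys                                           ≡⟨ below+above≡length (suc m) ys m∉ys ⟨
  below (suc m) ys + above (suc m) ys                 <⟨ s≤s (+-monoʳ-≤ (below (suc m) ys) (m≤m+n (above (suc m) ys) _)) ⟩
  1 + below (suc m) ys + 2 * above (suc m) ys         ∎
  where open ≤-Reasoning

below-determines-head : ∀ {j j′ xs ys} → j′ ∷ ys ↭ j ∷ xs → below j xs ≡ below j′ ys → j ≡ j′
below-determines-head {j} {j′} {xs} {ys} p eq =
  below-injective (here refl) (∈-resp-↭ p (here refl)) (begin
    below j (j ∷ xs)     ≡⟨ below-∷-self j xs ⟩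
    below j xs           ≡⟨ eq ⟩
    below j′ ys          ≡⟨ below-∷-self j′ ys ⟨
    below j′ (j′ ∷ ys)   ≡⟨ countᵇ-↭ _ p ⟩
    below j′ (j ∷ xs)    ∎)
  where open ≡-Reasoning

+-2*-cancelʳ : ∀ {a c a′ c′} → a + c ≡ a′ + c′ → a + 2 * c ≡ a′ + 2 * c′ → a ≡ a′
+-2*-cancelʳ {a} {c} {a′} {c′} sum≡ eq = +-cancelʳ-≡ c a a′ (trans sum≡ (cong (_+_ a′) (sym c≡c′)))
  where
  c≡c′ : c ≡ c′
  c≡c′ = +-cancelˡ-≡ (a + c) c c′
    (trans (sym (m+2*n≡m+n+n a c)) (trans eq (trans (m+2*n≡m+n+n a′ c′) (cong (_+ c′) (sym sum≡)))))

invAgainst-injective : ∀ {x y xs ys} → ∣ x ∣ ∉ xs → ∣ y ∣ ∉ ys → ∣ y ∣ ∷ ys ↭ ∣ x ∣ ∷ xs →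
  invAgainst x xs ≡ invAgainst y ys → x ≡ y
invAgainst-injective {+ j} {+ j′} _ _ p eq = cong +_ (below-determines-head p eq)
invAgainst-injective {+ j} { -[1+ m ]} {xs} {ys} _ y∉ys p eq =
  contradiction eq (<⇒≢ (invAgainst-nonneg<neg j m {xs} {ys} (sym (suc-injective (↭-length p))) y∉ys))
invAgainst-injective { -[1+ m ]} {+ j} {xs} {ys} x∉xs _ p eq =
  contradiction eq (>⇒≢ (invAgainst-nonneg<neg j m {ys} {xs} (suc-injective (↭-length p)) x∉xs))
invAgainst-injective { -[1+ m ]} { -[1+ m′ ]} {xs} {ys} x∉xs y∉ys p eq =
  cong -[1+_] (suc-injective (below-determines-head p (+-2*-cancelʳ sum≡ (suc-injective eq))))
  where
  sum≡ : below (suc m) xs + above (suc m) xs ≡ below (suc m′) ys + above (suc m′) ys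
  sum≡ = trans (below+above≡length _ xs x∉xs)
           (trans (sym (suc-injective (↭-length p))) (sym (below+above≡length _ ys y∉ys)))

invAgainst-neg-lookup : ∀ {xs} → AllPairs _<_ xs → All (0 <_) xs → (i : Fin (length xs)) →
  invAgainst (- + lookup xs i) (removeAt xs i) ≡ 1 + toℕ i + 2 * (length xs ∸ suc (toℕ i))
invAgainst-neg-lookup {xs} sorted pos i with lookup xs i | All.lookup pos (∈-lookup i)
  | below-lookup sorted i | above-lookup sorted i
... | suc m | _ | below≡ | above≡ = cong₂ (λ a c → 1 + a + 2 * c) below≡ above≡

-- Choosing the first entry

upper-half-decomposition : ∀ {n d} → n < d → d ≤ 2 * n + 1 → ∃ λ r → r ≤ n × 1 + r + 2 * (n ∸ r) ≡ d
upper-half-decomposition {n} {d} n<d d≤ = n ∸ k , m∸n≤m n k , (begin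
  1 + (n ∸ k) + 2 * (n ∸ (n ∸ k))   ≡⟨ cong (λ c → 1 + (n ∸ k) + 2 * c) (m∸[m∸n]≡n k≤n) ⟩
  1 + (n ∸ k) + 2 * k               ≡⟨ cong suc (m+2*n≡m+n+n (n ∸ k) k) ⟩
  1 + ((n ∸ k) + k + k)             ≡⟨ cong (λ a → suc (a + k)) (m∸n+n≡m k≤n) ⟩
  suc n + k                         ≡⟨ m+[n∸m]≡n n<d ⟩
  d                                 ∎)
  where
  open ≡-Reasoning
  k = d ∸ suc n
  2n+1≡1+n+n : ∀ n → 2 * n + 1 ≡ suc n + n
  2n+1≡1+n+n = solve-∀
  k≤n : k ≤ n
  k≤n = +-cancelˡ-≤ (suc n) k n (subst₂ _≤_ (sym (m+[n∸m]≡n n<d)) (2n+1≡1+n+n n) d≤)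

head-choice : ∀ {t ts d} → AllPairs _<_ (t ∷ ts) → All (0 <_) (t ∷ ts) → d ≤ 2 * length ts + 1 →
  ∃ λ (i : Fin (suc (length ts))) → ∃ λ x →
    ∣ x ∣ ≡ lookup (t ∷ ts) i × invAgainst x (removeAt (t ∷ ts) i) ≡ d
head-choice {t} {ts} {d} sorted pos d≤ with d ≤? length ts
... | yes d≤n = i , + lookup (t ∷ ts) i , refl ,
                trans (below-lookup sorted i) (toℕ-fromℕ< (s≤s d≤n))
  where i = fromℕ< (s≤s d≤n)
... | no  d≰n with upper-half-decomposition (≰⇒> d≰n) d≤
...   | r , r≤n , d≡ = i , - + lookup (t ∷ ts) i , ∣-i∣≡∣i∣ (+ _) ,
        trans (invAgainst-neg-lookup sorted pos i)
          (trans (cong (λ k → 1 + k + 2 * (length ts ∸ k)) (toℕ-fromℕ< (s≤s r≤n))) d≡)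
  where i = fromℕ< (s≤s r≤n)

-- Inversion sequences

count-magnitudes : (P : ℕ → Bool) (xs : Vec ℤ n) →
  count n (λ k → P ∣ lookupᵛ xs k ∣) ≡ countᵇ P (magnitudes xs)
count-magnitudes P []       = refl
count-magnitudes P (x ∷ xs) = trans (count-suc (λ k → P ∣ lookupᵛ (x ∷ xs) k ∣))
  (cong (_+_ (indicator (P ∣ x ∣))) (count-magnitudes P xs))

countAfter : (n : ℕ) → Vec ℤ n → Fin n → (ℕ → Bool) → ℕ
countAfter n v i P = count n (λ k → (toℕ i <ᵇ toℕ k) ∧ P ∣ lookupᵛ v k ∣)

countAfter-zero : ∀ x (xs : Vec ℤ n) P → countAfter (suc n) (x ∷ xs) zero P ≡ countᵇ P (magnitudes xs)
countAfter-zero x xs P =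
  trans (count-suc (λ k → (0 <ᵇ toℕ k) ∧ P ∣ lookupᵛ (x ∷ xs) k ∣)) (count-magnitudes P xs)

countAfter-suc : ∀ x (xs : Vec ℤ n) i P → countAfter (suc n) (x ∷ xs) (suc i) P ≡ countAfter n xs i P
countAfter-suc x xs i P = count-suc (λ k → (toℕ (suc i) <ᵇ toℕ k) ∧ P ∣ lookupᵛ (x ∷ xs) k ∣)

inv-head : ∀ x (xs : Vec ℤ n) → inv (suc n) (x ∷ xs) zero ≡ invAgainst x (magnitudes xs)
inv-head (+ j)    xs = countAfter-zero (+ j) xs (_<ᵇ j)
inv-head -[1+ m ] xs = cong₂ (λ a c → 1 + a + 2 * c)
  (countAfter-zero -[1+ m ] xs (_<ᵇ suc m)) (countAfter-zero -[1+ m ] xs (suc m <ᵇ_))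

inv-tail : ∀ x (xs : Vec ℤ n) i → inv (suc n) (x ∷ xs) (suc i) ≡ inv n xs i
inv-tail x xs i with lookupᵛ xs i
... | + j      = countAfter-suc x xs i (_<ᵇ j)
... | -[1+ m ] = cong₂ (λ a c → 1 + a + 2 * c)
  (countAfter-suc x xs i (_<ᵇ suc m)) (countAfter-suc x xs i (suc m <ᵇ_))

inv-≤ : (v : Vec ℤ n) (i : Fin n) → inv n v i ≤ 2 * (n ∸ suc (toℕ i)) + 1
inv-≤ {suc n} (x ∷ xs) zero = begin
  inv _ (x ∷ xs) zero                     ≡⟨ inv-head x xs ⟩
  invAgainst x (magnitudes xs)            ≤⟨ invAgainst-≤ x (magnitudes xs) ⟩
  2 * length (magnitudes xs) + 1          ≡⟨ cong (λ ℓ → 2 * ℓ + 1) (length-magnitudes xs) ⟩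
  2 * n + 1                               ∎
  where open ≤-Reasoning
inv-≤ (x ∷ xs) (suc i) = subst (_≤ _) (sym (inv-tail x xs i)) (inv-≤ xs i)

inv-injective : {v w : Vec ℤ n} → Unique (magnitudes v) → magnitudes w ↭ magnitudes v →
  (∀ i → inv n v i ≡ inv n w i) → v ≡ w
inv-injective {v = []}     {[]}     _ _ _ = refl
inv-injective {v = x ∷ xs} {y ∷ ys} unique@(_ ∷ unique-xs) w↭v eq
  with invAgainst-injective {x} {y} (Unique[x∷xs]⇒x∉xs unique)
         (Unique[x∷xs]⇒x∉xs (Unique-resp-↭ (↭⇒↭ₛ (↭-sym w↭v)) unique)) w↭v
         (trans (sym (inv-head x xs)) (trans (eq zero) (inv-head y ys)))
... | refl = cong (x ∷_) (inv-injective unique-xs (drop-∷ w↭v)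
               (λ i → trans (sym (inv-tail x xs i)) (trans (eq (suc i)) (inv-tail x ys i))))

inv-surjective : ∀ n {ts : List ℕ} → length ts ≡ n → AllPairs _<_ ts → All (0 <_) ts →
  (d : Fin n → ℕ) → (∀ i → d i ≤ 2 * (n ∸ suc (toℕ i)) + 1) →
  ∃ λ (v : Vec ℤ n) → magnitudes v ↭ ts × (∀ i → inv n v i ≡ d i)
inv-surjective zero    {[]}     refl _ _ d _ = [] , ↭-refl , λ ()
inv-surjective (suc n) {t ∷ ts} len sorted pos d d≤
  with head-choice sorted pos (subst (λ ℓ → d zero ≤ 2 * ℓ + 1) (sym (suc-injective len)) (d≤ zero))
... | i , x , ∣x∣≡ , head≡
  with inv-surjective n rest-length (AllPairs-removeAt sorted i) (All-removeAt pos i) (d ∘ suc) (d≤ ∘ suc)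
  where
  rest-length : length (removeAt (t ∷ ts) i) ≡ n
  rest-length = suc-injective (trans (sym (length-removeAt′ (t ∷ ts) i)) len)
... | v , v↭ , tail≡ =
  x ∷ v ,
  ↭-trans (↭-trans (↭-reflexive (cong (_∷ magnitudes v) ∣x∣≡)) (↭-prep _ v↭)) (lookup∷removeAt↭ (t ∷ ts) i) ,
  λ { zero    → trans (inv-head x v) (trans (invAgainst-↭ x v↭) head≡)
    ; (suc i) → trans (inv-tail x v i) (tail≡ i) }

-- Mixed radix with place values 2^i i!

weight : ℕ → ℕ
weight k = 2 ^ k * k !

weight-suc : ∀ k → weight k + (2 * k + 1) * weight k ≡ weight (suc k)
weight-suc k = lemma k (2 ^ k) (k !)
  where
  lemma : ∀ k a b → a * b + (2 * k + 1) * (a * b) ≡ (2 * a) * (b + k * b)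
  lemma = solve-∀

Admissible : Vec ℕ n → Set
Admissible {n} a = (i : Fin n) → lookupᵛ a i ≤ 2 * toℕ i + 1

fromDigits : Vec ℕ n → ℕ
fromDigits {n} a = sum (map (λ i → lookupᵛ a i * 2 ^ toℕ i * toℕ i !) (allFin n))

sum-lookup-∷ʳ : (g : ℕ → A → ℕ) (a : Vec A n) (x : A) →
  sum (map (λ i → g (toℕ i) (lookupᵛ (a ∷ʳ x) i)) (allFin (suc n))) ≡
  sum (map (λ i → g (toℕ i) (lookupᵛ a i)) (allFin n)) + g n x
sum-lookup-∷ʳ g []      x = +-comm (g 0 x) 0
sum-lookup-∷ʳ {n = suc n} g (y ∷ a) x = begin
  sum (map (λ i → g (toℕ i) (lookupᵛ ((y ∷ a) ∷ʳ x) i)) (allFin (suc (suc n))))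
    ≡⟨ sum-map-allFin-suc (λ i → g (toℕ i) (lookupᵛ ((y ∷ a) ∷ʳ x) i)) ⟩
  g 0 y + sum (map (λ i → g (suc (toℕ i)) (lookupᵛ (a ∷ʳ x) i)) (allFin (suc n)))
    ≡⟨ cong (_+_ (g 0 y)) (sum-lookup-∷ʳ (g ∘ suc) a x) ⟩
  g 0 y + (sum (map (λ i → g (suc (toℕ i)) (lookupᵛ a i)) (allFin n)) + g (suc n) x)
    ≡⟨ +-assoc (g 0 y) _ _ ⟨
  g 0 y + sum (map (λ i → g (suc (toℕ i)) (lookupᵛ a i)) (allFin n)) + g (suc n) x
    ≡⟨ cong (_+ g (suc n) x) (sum-map-allFin-suc (λ i → g (toℕ i) (lookupᵛ (y ∷ a) i))) ⟨
  sum (map (λ i → g (toℕ i) (lookupᵛ (y ∷ a) i)) (allFin (suc n))) + g (suc n) x ∎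
  where open ≡-Reasoning

lookup-∷ʳ⁻ : (P : ℕ → A → Set) (a : Vec A n) (x : A) →
  (∀ i → P (toℕ i) (lookupᵛ (a ∷ʳ x) i)) → (∀ i → P (toℕ i) (lookupᵛ a i)) × P n x
lookup-∷ʳ⁻ P []      x Pa∷ʳx = (λ ()) , Pa∷ʳx zero
lookup-∷ʳ⁻ P (y ∷ a) x Pa∷ʳx =
  (λ { zero → Pa∷ʳx zero ; (suc i) → proj₁ Pa∷ʳx-tail i }) , proj₂ Pa∷ʳx-tail
  where Pa∷ʳx-tail = lookup-∷ʳ⁻ (P ∘ suc) a x (Pa∷ʳx ∘ suc)

fromDigits-∷ʳ : (a : Vec ℕ n) (d : ℕ) → fromDigits (a ∷ʳ d) ≡ fromDigits a + d * weight n
fromDigits-∷ʳ {n} a d =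
  trans (sum-lookup-∷ʳ (λ k y → y * 2 ^ k * k !) a d) (cong (_+_ (fromDigits a)) (*-assoc d (2 ^ n) (n !)))

admissible-∷ʳ⁻ : (a : Vec ℕ n) (d : ℕ) → Admissible (a ∷ʳ d) → Admissible a × d ≤ 2 * n + 1
admissible-∷ʳ⁻ = lookup-∷ʳ⁻ (λ k y → y ≤ 2 * k + 1)

fromDigits-< : (a : Vec ℕ n) → Admissible a → fromDigits a < weight n
fromDigits-< []        _   = s≤s z≤n
fromDigits-< {suc n} a adm with initLast a
... | a′ , d , refl = begin-strict
  fromDigits (a′ ∷ʳ d)                 ≡⟨ fromDigits-∷ʳ a′ d ⟩
  fromDigits a′ + d * weight n         <⟨ +-monoˡ-< _ (fromDigits-< a′ (proj₁ (admissible-∷ʳ⁻ a′ d adm))) ⟩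
  weight n + d * weight n              ≤⟨ +-monoʳ-≤ (weight n) (*-monoˡ-≤ (weight n) (proj₂ (admissible-∷ʳ⁻ a′ d adm))) ⟩
  weight n + (2 * n + 1) * weight n    ≡⟨ weight-suc n ⟩
  weight (suc n)                       ∎
  where open ≤-Reasoning

+-*-unique : ∀ {w r r′ q q′} → r < w → r′ < w → r + q * w ≡ r′ + q′ * w → r ≡ r′ × q ≡ q′
+-*-unique {w} {r} {r′} {q} {q′} r<w r′<w eq = r≡r′ , *-cancelʳ-≡ q q′ w (+-cancelˡ-≡ r _ _ (trans eq (cong (_+ q′ * w) (sym r≡r′))))
  where
  instance
    w≢0 : NonZero w
    w≢0 = >-nonZero (≤-trans (s≤s z≤n) r<w)
  open ≡-Reasoning
  r≡r′ : r ≡ r′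
  r≡r′ = begin
    r                  ≡⟨ m<n⇒m%n≡m r<w ⟨
    r % w              ≡⟨ [m+kn]%n≡m%n r q w ⟨
    (r + q * w) % w    ≡⟨ cong (_% w) eq ⟩
    (r′ + q′ * w) % w  ≡⟨ [m+kn]%n≡m%n r′ q′ w ⟩
    r′ % w             ≡⟨ m<n⇒m%n≡m r′<w ⟩
    r′                 ∎

fromDigits-injective : {a b : Vec ℕ n} → Admissible a → Admissible b → fromDigits a ≡ fromDigits b → a ≡ b
fromDigits-injective {zero} {[]} {[]} _ _ _ = refl
fromDigits-injective {suc n} {a} {b} adm-a adm-b eq with initLast a | initLast b
... | a′ , d , refl | b′ , e , refl = cong₂ _∷ʳ_ (fromDigits-injective adm-a′ adm-b′ low≡) high≡
  where
  adm-a′ = proj₁ (admissible-∷ʳ⁻ a′ d adm-a)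
  adm-b′ = proj₁ (admissible-∷ʳ⁻ b′ e adm-b)
  low≡,high≡ = +-*-unique (fromDigits-< a′ adm-a′) (fromDigits-< b′ adm-b′)
    (trans (sym (fromDigits-∷ʳ a′ d)) (trans eq (fromDigits-∷ʳ b′ e)))
  low≡ = proj₁ low≡,high≡
  high≡ = proj₂ low≡,high≡

inversionDigits : Vec ℤ n → Vec ℕ n
inversionDigits {n} v = tabulate (λ i → inv n v (opposite i))

b≡fromDigits : (v : Vec ℤ n) → b n v ≡ fromDigits (inversionDigits v)
b≡fromDigits {n} v = cong sum (map-cong
  (λ i → cong (λ y → y * 2 ^ toℕ i * toℕ i !) (sym (lookup∘tabulate _ i))) (allFin n))

toℕ-opposite-opposite : (i : Fin n) → n ∸ suc (toℕ (opposite i)) ≡ toℕ i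
toℕ-opposite-opposite i = trans (sym (opposite-prop (opposite i))) (cong toℕ (opposite-involutive i))

inversionDigits-admissible : (v : Vec ℤ n) → Admissible (inversionDigits v)
inversionDigits-admissible {n} v i =
  subst₂ _≤_ (sym (lookup∘tabulate _ i)) (cong (λ k → 2 * k + 1) (toℕ-opposite-opposite i)) (inv-≤ v (opposite i))

inversionDigits-injective : {v w : Vec ℤ n} → Unique (magnitudes v) → magnitudes w ↭ magnitudes v →
  inversionDigits v ≡ inversionDigits w → v ≡ w
inversionDigits-injective {n} {v} {w} unique w↭v eq = inv-injective unique w↭v λ i → begin
  inv n v i                                ≡⟨ cong (inv n v) (opposite-involutive i) ⟨
  inv n v (opposite (opposite i))          ≡⟨ lookup∘tabulate _ (opposite i) ⟨
  lookupᵛ (inversionDigits v) (opposite i) ≡⟨ cong (λ a → lookupᵛ a (opposite i)) eq ⟩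
  lookupᵛ (inversionDigits w) (opposite i) ≡⟨ lookup∘tabulate _ (opposite i) ⟩
  inv n w (opposite (opposite i))          ≡⟨ cong (inv n w) (opposite-involutive i) ⟩
  inv n w i                                ∎
  where open ≡-Reasoning

inversionDigits-surjective : {ts : List ℕ} → length ts ≡ n → AllPairs _<_ ts → All (0 <_) ts →
  (a : Vec ℕ n) → Admissible a → ∃ λ (v : Vec ℤ n) → magnitudes v ↭ ts × inversionDigits v ≡ a
inversionDigits-surjective {n} len sorted pos a adm
  with inv-surjective n len sorted pos (lookupᵛ a ∘ opposite)
         (λ i → subst (λ k → lookupᵛ a (opposite i) ≤ 2 * k + 1) (opposite-prop i) (adm (opposite i)))
... | v , v↭ , inv≡ = v , v↭ , trans (tabulate-cong λ i →
        trans (inv≡ (opposite i)) (cong (lookupᵛ a) (opposite-involutive i))) (tabulate∘lookup a)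

suc-upTo-sorted : ∀ n → AllPairs _<_ (map Data.Nat.suc (upTo n))
suc-upTo-sorted n = AllPairs.map⁺ (AllPairs.applyUpTo⁺₁ id n (λ i<j _ → s≤s i<j))

suc-upTo-positive : ∀ n → All (0 <_) (map Data.Nat.suc (upTo n))
suc-upTo-positive n = All.map⁺ (All.universal (λ _ → s≤s z≤n) (upTo n))

length-suc-upTo : ∀ n → length (map Data.Nat.suc (upTo n)) ≡ n
length-suc-upTo n = trans (length-map Data.Nat.suc (upTo n)) (length-upTo n)

signedPerm-unique : ∀ {n} (π : SignedPerm n) → Unique (magnitudes (proj₁ π))
signedPerm-unique {n} (_ , π↭) = Unique-resp-↭ (↭⇒↭ₛ (↭-sym π↭)) (AllPairs.map <⇒≢ (suc-upTo-sorted n))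

theorem3p5 : (n : ℕ) → 1 ≤ n →
    ((π : SignedPerm n) → InTarget n (b n (proj₁ π))) ×
    ((π σ : SignedPerm n) → b n (proj₁ π) ≡ b n (proj₁ σ) → proj₁ π ≡ proj₁ σ) ×
    ((m : ℕ) → InTarget n m → ∃ λ (π : SignedPerm n) → b n (proj₁ π) ≡ m)
theorem3p5 n _ = well-defined , injective , surjective
  where
  well-defined : (π : SignedPerm n) → InTarget n (b n (proj₁ π))
  well-defined (v , _) = inversionDigits v , inversionDigits-admissible v , b≡fromDigits v

  injective : (π σ : SignedPerm n) → b n (proj₁ π) ≡ b n (proj₁ σ) → proj₁ π ≡ proj₁ σ
  injective π@(v , v↭) (w , w↭) eq =
    inversionDigits-injective (signedPerm-unique π) (↭-trans w↭ (↭-sym v↭))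
      (fromDigits-injective (inversionDigits-admissible v) (inversionDigits-admissible w)
        (trans (sym (b≡fromDigits v)) (trans eq (b≡fromDigits w))))

  surjective : (m : ℕ) → InTarget n m → ∃ λ (π : SignedPerm n) → b n (proj₁ π) ≡ m
  surjective m (a , adm , m≡) with inversionDigits-surjective
    (length-suc-upTo n) (suc-upTo-sorted n) (suc-upTo-positive n) a adm
  ... | v , v↭ , digits≡ = (v , v↭) , trans (b≡fromDigits v) (trans (cong fromDigits digits≡) (sym m≡))
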